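{- If $\mathbf b = \downarrow_1 \mathbf c$, then $\mathrm{ru}(\mathbf b,d) = \downarrow_1 \mathrm{ru}'(\mathbf c,d)$.
   Context: Parity game with colour set $C\subseteq\{1,2,\ldots\}$ (consecutive, starting at $1$ or $2$); $C^-=C\setminus\{\max C\}$ if $\max C$ is odd, and $C^-=C$ otherwise; $e$ is the number of vertices with even colour. A (classic) witness is a sequence $b_k,\ldots,b_0$ with $b_i\in C^-\cup\{\_\}$ (backed by suitable $i$-witnesses in the play prefix), with $b_0$ even or $\_$; $\mathbb W$ is the set of witnesses of value at most $e$ together with a special winning state $\top$. The raw update $\mathrm{ru}'(\mathbf b,d)$ upon reading a vertex of colour $d$ is: (i) if $d$ is even and there is $j$ with $b_i$ even for all $i<j$, $b_j$ odd or $\_$, and $b_i\ge d$ or $\_$ for all $i>j$: keep $b_i$ for $i>j$, set position $j$ to $d$ and positions $<j$ to $\_$; (ii) if $d\in C^-$ and there is $j$ with $d>b_j\neq\_$ and $b_i\ge d$ or $\_$ for all $i>j$: keep $b_i$ for $i>j$, set position $j$ to $d$ (to $\_$ if $j=0$) and positions $<j$ to $\_$; (iii) if $d\in C^-$ is odd and every $b_j$ is $\_$ or $\ge d$: leave the witness unchanged; (iv) if $d=\max C$ is odd: reset to $\_,\ldots,\_$. The truncation operator $\downarrow_1$ keeps, for every odd colour $o\in C^-$, only the leftmost occurrence of $o$ in a witness and replaces all other occurrences by $\_$ (e.g. $\downarrow_1 3,3,2 = 3,\_,2$), and $\downarrow_1\top=\top$. The concise raw update is $\mathrm{ru}(\mathbf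 b,d)=\downarrow_1 \mathrm{ru}'(\mathbf b,d)$. -}

module Defs where

open import Data.Nat using (ℕ; zero; suc; _≤_; _<_; _%_)
import Data.Nat as ℕ
import Data.Nat.Properties as ℕP
open import Data.Fin using (Fin; zero; suc) renaming (_<_ to _<ᶠ_)
open import Data.Fin.Properties using (any?; all?) renaming (_<?_ to _<ᶠ?_)
open import Data.Vec using (Vec; lookup; tabulate; replicate)
open import Data.Maybe using (Maybe; just; nothing)
import Data.Maybe.Properties as MP
open import Data.Product using (_×_; _,_; ∃)
open import Data.Sum using (_⊎_)
open import Data.Unit using (⊤; tt)
open import Data.Empty using (⊥)
open import Relation.Nullary using (Dec; yes; no; ¬_)
open import Relation.Nullary.Decidable using (_×-dec_; _→-dec_; ¬?)
open import Relation.Binary.PropositionalEquality using (_≡_)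

Even : ℕ → Set
Even n = n % 2 ≡ 0

Odd : ℕ → Set
Odd n = n % 2 ≡ 1

even? : (n : ℕ) → Dec (Even n)
even? n = (n % 2) ℕ.≟ 0

odd? : (n : ℕ) → Dec (Odd n)
odd? n = (n % 2) ℕ.≟ 1

-- Colour sets: C = {lo, lo+1, ..., hi} with lo ∈ {1,2}

record Colours : Set where
  field
    lo    : ℕ
    hi    : ℕ
    lo-ok : lo ≡ 1 ⊎ lo ≡ 2
    lo≤hi : lo ≤ hi
open Colours public

InC : Colours → ℕ → Set
InC C d = lo C ≤ d × d ≤ hi C

inC? : (C : Colours) (d : ℕ) → Dec (InC C d)
inC? C d = (lo C ℕP.≤? d) ×-dec (d ℕP.≤? hi C)

InC⁻ : Colours → ℕ → Set
InC⁻ C d = InC C d × ¬ (d ≡ hi C × Odd (hi C))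

inC⁻? : (C : Colours) (d : ℕ) → Dec (InC⁻ C d)
inC⁻? C d = inC? C d ×-dec ¬? ((d ℕ.≟ hi C) ×-dec odd? (hi C))

-- An entry is 'just c' (a colour) or 'nothing' (the blank _).
-- A witness b_k,…,b_0 is a vector v of length n = k+1 with b_i = lookup v i,
-- so position 0 is b_0 (rightmost) and position k is b_k (leftmost).
-- 'top' is the special winning state ⊤.

Entry : Set
Entry = Maybe ℕ

data Wit (n : ℕ) : Set where
  top : Wit n
  wit : Vec Entry n → Wit n

EntryOK : Colours → Entry → Set
EntryOK C nothing  = ⊤
EntryOK C (just c) = InC⁻ C c

EvenOrBlank : Entry → Set
EvenOrBlank nothing  = ⊤
EvenOrBlank (just c) = Even c

WellFormed : Colours → {n : ℕ} → Wit n → Set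
WellFormed C top = ⊤
WellFormed C {zero} (wit b) = ⊥
WellFormed C {suc k} (wit b) = (∀ i → EntryOK C (lookup b i)) × EvenOrBlank (lookup b zero)

IsEven : Entry → Set
IsEven nothing  = ⊥
IsEven (just c) = Even c

isEven? : (e : Entry) → Dec (IsEven e)
isEven? nothing  = no (λ ())
isEven? (just c) = even? c

OddOrBlank : Entry → Set
OddOrBlank nothing  = ⊤
OddOrBlank (just c) = Odd c

oddOrBlank? : (e : Entry) → Dec (OddOrBlank e)
oddOrBlank? nothing  = yes tt
oddOrBlank? (just c) = odd? c

GeOrBlank : ℕ → Entry → Set
GeOrBlank d nothing  = ⊤
GeOrBlank d (just c) = d ≤ c

geOrBlank? : (d : ℕ) (e : Entry) → Dec (GeOrBlank d e)
geOrBlank? d nothing  = yes tt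
geOrBlank? d (just c) = d ℕP.≤? c

Below : ℕ → Entry → Set
Below d nothing  = ⊥
Below d (just c) = c < d

below? : (d : ℕ) (e : Entry) → Dec (Below d e)
below? d nothing  = no (λ ())
below? d (just c) = c ℕP.<? d

module _ {n : ℕ} (b : Vec Entry n) (d : ℕ) where

  CondI : Fin n → Set
  CondI j = (∀ i → i <ᶠ j → IsEven (lookup b i))
          × OddOrBlank (lookup b j)
          × (∀ i → j <ᶠ i → GeOrBlank d (lookup b i))

  condI? : (j : Fin n) → Dec (CondI j)
  condI? j = all? (λ i → (i <ᶠ? j) →-dec isEven? (lookup b i))
       ×-dec oddOrBlank? (lookup b j)
       ×-dec all? (λ i → (j <ᶠ? i) →-dec geOrBlank? d (lookup b i))

  CondII : Fin n → Set
  CondII j = Below d (lookup b j) × (∀ i → j <ᶠ i → GeOrBlank d (lookup b i))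

  condII? : (j : Fin n) → Dec (CondII j)
  condII? j = below? d (lookup b j)
        ×-dec all? (λ i → (j <ᶠ? i) →-dec geOrBlank? d (lookup b i))

  CondIII : Set
  CondIII = ∀ j → GeOrBlank d (lookup b j)

  condIII? : Dec CondIII
  condIII? = all? (λ j → geOrBlank? d (lookup b j))

setAt : {n : ℕ} → Vec Entry n → Fin n → Entry → Vec Entry n
setAt {n} b j x = tabulate f
  where
  f : Fin n → Entry
  f i with i <ᶠ? j | i Data.Fin.Properties.≟ j
  ... | yes _ | _     = nothing
  ... | no _  | yes _ = x
  ... | no _  | no _  = lookup b i

caseIIValue : {n : ℕ} → Fin n → ℕ → Entry
caseIIValue zero    d = nothing
caseIIValue (suc _) d = just d

-- The raw update ru'(b, d).  Cases are tried in the order (i), (ii), (iii), (iv);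
-- if none applies (only possible for even d with all entries even and ≥ d)
-- the result is ⊤.  ru'(⊤, d) = ⊤.

private
  ru′-iv : (C : Colours) {n : ℕ} → Vec Entry n → ℕ → Wit n
  ru′-iv C {n} b d with d ℕ.≟ hi C | odd? (hi C)
  ... | yes _ | yes _ = wit (replicate n nothing)
  ... | _     | _     = top

  ru′-iii : (C : Colours) {n : ℕ} → Vec Entry n → ℕ → Wit n
  ru′-iii C b d with inC⁻? C d | odd? d | condIII? b d
  ... | yes _ | yes _ | yes _ = wit b
  ... | _     | _     | _     = ru′-iv C b d

  ru′-ii : (C : Colours) {n : ℕ} → Vec Entry n → ℕ → Wit n
  ru′-ii C b d with inC⁻? C d | any? (condII? b d)
  ... | yes _ | yes (j , _) = wit (setAt b j (caseIIValue j d))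
  ... | _     | _           = ru′-iii C b d

  ru′-i : (C : Colours) {n : ℕ} → Vec Entry n → ℕ → Wit n
  ru′-i C b d with even? d | any? (condI? b d)
  ... | yes _ | yes (j , _) = wit (setAt b j (just d))
  ... | _     | _           = ru′-ii C b d

ru′ : (C : Colours) {n : ℕ} → Wit n → ℕ → Wit n
ru′ C top     d = top
ru′ C (wit b) d = ru′-i C b d

-- Truncation ↓₁: for every odd o ∈ C⁻ keep only the leftmost occurrence
-- (the one with the largest index) and replace the others by _.

truncEntry : (C : Colours) {n : ℕ} → Vec Entry n → Fin n → Entry
truncEntry C b i with lookup b i
... | nothing = nothing
... | just o with odd? o ×-dec inC⁻? C o
                ×-dec any? (λ i′ → (i <ᶠ? i′) ×-dec MP.≡-dec ℕ._≟_ (lookup b i′) (just o))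
...   | yes _ = nothing
...   | no _  = just o

↓₁ : (C : Colours) {n : ℕ} → Wit n → Wit n
↓₁ C top     = top
↓₁ C (wit b) = wit (tabulate (truncEntry C b))

ru : (C : Colours) {n : ℕ} → Wit n → ℕ → Wit n
ru C b d = ↓₁ C (ru′ C b d)

module Submission where

-- Truncation only erases shadowed entries: occurrences of an odd colour of C⁻ that occurs again
-- further left, where its leftmost occurrence survives. So each case condition of the raw update
-- holds of ↓₁ c at position j exactly when it holds of c, the position j is unique, and truncation
-- cannot tell c from ↓₁ c, not even after positions up to j are overwritten. Hence ru′ takes the
-- same branch on ↓₁ c as on c, and the two results agree after truncation.

open import Defs
open import Data.Nat using (ℕ; suc)
open import Relation.Binary.PropositionalEquality using (_≡_; refl; sym; trans; cong; subst)

import Data.Nat as ℕ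
import Data.Nat.Properties as ℕP
open import Data.Fin using (Fin) renaming (_<_ to _<ᶠ_; _≤_ to _≤ᶠ_)
open import Data.Fin.Properties using (any?; <-cmp)
  renaming (_<?_ to _<ᶠ?_; _≟_ to _≟ᶠ_; <-trans to <ᶠ-trans; <-irrefl to <ᶠ-irrefl; ≤-refl to ≤ᶠ-refl)
open import Data.Fin.Induction using (>-wellFounded)
open import Data.Vec using (Vec; lookup; tabulate)
open import Data.Vec.Properties using (lookup∘tabulate; tabulate-cong)
import Data.Maybe.Properties as MP
open import Data.Maybe using (just; nothing)
open import Data.Product using (_×_; _,_; ∃)
open import Data.Sum using (_⊎_; inj₁; inj₂)
open import Data.Unit using (tt)
open import Data.Empty using (⊥-elim)
open import Function.Base using (_∋_)
open import Function.Bundles using (_⇔_; mk⇔; Equivalence)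
import Function.Properties.Equivalence as ⇔
open import Induction.WellFounded using (Acc; acc)
open import Relation.Nullary using (Dec; yes; no; ¬_)
open import Relation.Nullary.Decidable using (_×-dec_)
open import Relation.Binary.Definitions using (tri<; tri≈; tri>)

open Equivalence using (to; from)

even⇒¬odd : ∀ {v} → Even v → ¬ Odd v
even⇒¬odd e o with trans (sym e) o
... | ()

isEven⇒¬oddOrBlank : ∀ e → IsEven e → ¬ OddOrBlank e
isEven⇒¬oddOrBlank (just v) = even⇒¬odd {v}

geOrBlank⇒¬below : ∀ d e → GeOrBlank d e → ¬ Below d e
geOrBlank⇒¬below d (just v) = ℕP.≤⇒≯

module _ {n : ℕ} (x : Vec Entry n) (j : Fin n) (v : Entry) where

  setAt-< : ∀ i → i <ᶠ j → lookup (setAt x j v) i ≡ nothing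
  setAt-< i i<j with i <ᶠ? j | (lookup (setAt x j v) i ≡ _ ∋ lookup∘tabulate _ i)
  ... | yes _  | eq = eq
  ... | no i≮j | _  = ⊥-elim (i≮j i<j)

  setAt-≡ : lookup (setAt x j v) j ≡ v
  setAt-≡ with j <ᶠ? j | j ≟ᶠ j | (lookup (setAt x j v) j ≡ _ ∋ lookup∘tabulate _ j)
  ... | yes j<j | _      | _  = ⊥-elim (<ᶠ-irrefl refl j<j)
  ... | no _    | yes _  | eq = eq
  ... | no _    | no j≢j | _  = ⊥-elim (j≢j refl)

  setAt-> : ∀ i → j <ᶠ i → lookup (setAt x j v) i ≡ lookup x i
  setAt-> i j<i with i <ᶠ? j | i ≟ᶠ j | (lookup (setAt x j v) i ≡ _ ∋ lookup∘tabulate _ i)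
  ... | yes i<j | _       | _  = ⊥-elim (<ᶠ-irrefl refl (<ᶠ-trans i<j j<i))
  ... | no _    | yes i≡j | _  = ⊥-elim (<ᶠ-irrefl (sym i≡j) j<i)
  ... | no _    | no _    | eq = eq

module _ {n : ℕ} (x : Vec Entry n) (d : ℕ) where

  condI-unique : ∀ {j j′} → CondI x d j → CondI x d j′ → j ≡ j′
  condI-unique {j} {j′} (evens , oddOrBlank , _) (evens′ , oddOrBlank′ , _) with <-cmp j j′
  ... | tri< j<j′ _ _ = ⊥-elim (isEven⇒¬oddOrBlank (lookup x j) (evens′ j j<j′) oddOrBlank)
  ... | tri≈ _ j≡j′ _ = j≡j′
  ... | tri> _ _ j′<j = ⊥-elim (isEven⇒¬oddOrBlank (lookup x j′) (evens j′ j′<j) oddOrBlank′)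

  condII-unique : ∀ {j j′} → CondII x d j → CondII x d j′ → j ≡ j′
  condII-unique {j} {j′} (below , ge) (below′ , ge′) with <-cmp j j′
  ... | tri< j<j′ _ _ = ⊥-elim (geOrBlank⇒¬below d (lookup x j′) (ge j′ j<j′) below′)
  ... | tri≈ _ j≡j′ _ = j≡j′
  ... | tri> _ _ j′<j = ⊥-elim (geOrBlank⇒¬below d (lookup x j) (ge′ j j′<j) below)

record RuEquivalent (C : Colours) (d : ℕ) {n : ℕ} (x y : Vec Entry n) : Set where
  field
    condI⇔   : ∀ j → CondI x d j ⇔ CondI y d j
    condII⇔  : ∀ j → CondII x d j ⇔ CondII y d j
    condIII⇔ : CondIII x d ⇔ CondIII y d
    ↓₁-setAt : ∀ j v → ↓₁ C (wit (setAt x j v)) ≡ ↓₁ C (wit (setAt y j v))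
    ↓₁-wit   : ↓₁ C (wit x) ≡ ↓₁ C (wit y)

module _ {C : Colours} {d : ℕ} {n : ℕ} {x y : Vec Entry n} (x~y : RuEquivalent C d x y) where
  open RuEquivalent x~y

  ↓₁-setAt-condI : ∀ {j j′} v → CondI x d j → CondI y d j′ → ↓₁ C (wit (setAt x j v)) ≡ ↓₁ C (wit (setAt y j′ v))
  ↓₁-setAt-condI {j} v p q with condI-unique y d (to (condI⇔ j) p) q
  ... | refl = ↓₁-setAt j v

  ↓₁-setAt-condII : ∀ {j j′} → CondII x d j → CondII y d j′
    → ↓₁ C (wit (setAt x j (caseIIValue j d))) ≡ ↓₁ C (wit (setAt y j′ (caseIIValue j′ d)))
  ↓₁-setAt-condII {j} p q with condII-unique y d (to (condII⇔ j) p) q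
  ... | refl = ↓₁-setAt j (caseIIValue j d)

  -- Each case test of ru′ has the same outcome on x and y, so both sides take the same branch.
  -- The branches of ru′ are private with-functions, so each fall-through is re-entered separately.
  ru-cong : ru C (wit x) d ≡ ru C (wit y) d
  ru-cong with even? d | any? (condI? x d) | any? (condI? y d)
  ... | yes _ | yes (_ , p) | yes (_ , q) = ↓₁-setAt-condI (just d) p q
  ... | yes _ | yes (j , p) | no ¬q = ⊥-elim (¬q (j , to (condI⇔ j) p))
  ... | yes _ | no ¬p | yes (j , q) = ⊥-elim (¬p (j , from (condI⇔ j) q))
  ... | yes _ | no _ | no _ with inC⁻? C d | any? (condII? x d) | any? (condII? y d)
  ... | yes _ | yes (_ , p) | yes (_ , q) = ↓₁-setAt-condII p q
  ... | yes _ | yes (j , p) | no ¬q = ⊥-elim (¬q (j , to (condII⇔ j) p))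
  ... | yes _ | no ¬p | yes (j , q) = ⊥-elim (¬p (j , from (condII⇔ j) q))
  ... | yes _ | no _ | no _ with inC⁻? C d | odd? d | condIII? x d | condIII? y d
  ... | yes _ | yes _ | yes _ | yes _ = ↓₁-wit
  ... | yes _ | yes _ | yes p | no ¬q = ⊥-elim (¬q (to condIII⇔ p))
  ... | yes _ | yes _ | no ¬p | yes q = ⊥-elim (¬p (from condIII⇔ q))
  ... | yes _ | yes _ | no _ | no _ with d ℕ.≟ hi C | odd? (hi C)
  ... | yes _ | yes _ = refl
  ... | yes _ | no _ = refl
  ... | no _ | _ = refl
  ru-cong | yes _ | no _ | no _ | yes _ | no _ | no _ | yes _ | no _ | _ | _ with d ℕ.≟ hi C | odd? (hi C)
  ... | yes _ | yes _ = refl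
  ... | yes _ | no _ = refl
  ... | no _ | _ = refl
  ru-cong | yes _ | no _ | no _ | yes _ | no _ | no _ | no _ | _ | _ | _ with d ℕ.≟ hi C | odd? (hi C)
  ... | yes _ | yes _ = refl
  ... | yes _ | no _ = refl
  ... | no _ | _ = refl
  ru-cong | yes _ | no _ | no _ | no _ | _ | _ with inC⁻? C d | odd? d | condIII? x d | condIII? y d
  ... | yes _ | yes _ | yes _ | yes _ = ↓₁-wit
  ... | yes _ | yes _ | yes p | no ¬q = ⊥-elim (¬q (to condIII⇔ p))
  ... | yes _ | yes _ | no ¬p | yes q = ⊥-elim (¬p (from condIII⇔ q))
  ... | yes _ | yes _ | no _ | no _ with d ℕ.≟ hi C | odd? (hi C)
  ... | yes _ | yes _ = refl
  ... | yes _ | no _ = refl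
  ... | no _ | _ = refl
  ru-cong | yes _ | no _ | no _ | no _ | _ | _ | yes _ | no _ | _ | _ with d ℕ.≟ hi C | odd? (hi C)
  ... | yes _ | yes _ = refl
  ... | yes _ | no _ = refl
  ... | no _ | _ = refl
  ru-cong | yes _ | no _ | no _ | no _ | _ | _ | no _ | _ | _ | _ with d ℕ.≟ hi C | odd? (hi C)
  ... | yes _ | yes _ = refl
  ... | yes _ | no _ = refl
  ... | no _ | _ = refl
  ru-cong | no _ | _ | _ with inC⁻? C d | any? (condII? x d) | any? (condII? y d)
  ... | yes _ | yes (_ , p) | yes (_ , q) = ↓₁-setAt-condII p q
  ... | yes _ | yes (j , p) | no ¬q = ⊥-elim (¬q (j , to (condII⇔ j) p))
  ... | yes _ | no ¬p | yes (j , q) = ⊥-elim (¬p (j , from (condII⇔ j) q))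
  ... | yes _ | no _ | no _ with inC⁻? C d | odd? d | condIII? x d | condIII? y d
  ... | yes _ | yes _ | yes _ | yes _ = ↓₁-wit
  ... | yes _ | yes _ | yes p | no ¬q = ⊥-elim (¬q (to condIII⇔ p))
  ... | yes _ | yes _ | no ¬p | yes q = ⊥-elim (¬p (from condIII⇔ q))
  ... | yes _ | yes _ | no _ | no _ with d ℕ.≟ hi C | odd? (hi C)
  ... | yes _ | yes _ = refl
  ... | yes _ | no _ = refl
  ... | no _ | _ = refl
  ru-cong | no _ | _ | _ | yes _ | no _ | no _ | yes _ | no _ | _ | _ with d ℕ.≟ hi C | odd? (hi C)
  ... | yes _ | yes _ = refl
  ... | yes _ | no _ = refl
  ... | no _ | _ = refl
  ru-cong | no _ | _ | _ | yes _ | no _ | no _ | no _ | _ | _ | _ with d ℕ.≟ hi C | odd? (hi C)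
  ... | yes _ | yes _ = refl
  ... | yes _ | no _ = refl
  ... | no _ | _ = refl
  ru-cong | no _ | _ | _ | no _ | _ | _ with inC⁻? C d | odd? d | condIII? x d | condIII? y d
  ... | yes _ | yes _ | yes _ | yes _ = ↓₁-wit
  ... | yes _ | yes _ | yes p | no ¬q = ⊥-elim (¬q (to condIII⇔ p))
  ... | yes _ | yes _ | no ¬p | yes q = ⊥-elim (¬p (from condIII⇔ q))
  ... | yes _ | yes _ | no _ | no _ with d ℕ.≟ hi C | odd? (hi C)
  ... | yes _ | yes _ = refl
  ... | yes _ | no _ = refl
  ... | no _ | _ = refl
  ru-cong | no _ | _ | _ | no _ | _ | _ | yes _ | no _ | _ | _ with d ℕ.≟ hi C | odd? (hi C)
  ... | yes _ | yes _ = refl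
  ... | yes _ | no _ = refl
  ... | no _ | _ = refl
  ru-cong | no _ | _ | _ | no _ | _ | _ | no _ | _ | _ | _ with d ℕ.≟ hi C | odd? (hi C)
  ... | yes _ | yes _ = refl
  ... | yes _ | no _ = refl
  ... | no _ | _ = refl

module Truncation (C : Colours) {n : ℕ} where

  Above : Vec Entry n → Fin n → ℕ → Set
  Above x i o = ∃ λ i′ → i <ᶠ i′ × lookup x i′ ≡ just o

  Shadowed : Vec Entry n → Fin n → ℕ → Set
  Shadowed x i o = Odd o × InC⁻ C o × Above x i o

  shadowed? : ∀ x i o → Dec (Shadowed x i o)
  shadowed? x i o = odd? o ×-dec inC⁻? C o
    ×-dec any? (λ i′ → (i <ᶠ? i′) ×-dec MP.≡-dec ℕ._≟_ (lookup x i′) (just o))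

  module _ (x : Vec Entry n) (i : Fin n) where

    truncEntry-nothing : lookup x i ≡ nothing → truncEntry C x i ≡ nothing
    truncEntry-nothing eq with lookup x i | eq
    ... | .nothing | refl = refl

    truncEntry-shadowed : ∀ {o} → lookup x i ≡ just o → Shadowed x i o → truncEntry C x i ≡ nothing
    truncEntry-shadowed {o} eq s with lookup x i | eq
    ... | .(just o) | refl with shadowed? x i o
    ...   | yes _ = refl
    ...   | no ¬s = ⊥-elim (¬s s)

    truncEntry-visible : ∀ {o} → lookup x i ≡ just o → ¬ Shadowed x i o → truncEntry C x i ≡ just o
    truncEntry-visible {o} eq ¬s with lookup x i | eq
    ... | .(just o) | refl with shadowed? x i o
    ...   | yes s = ⊥-elim (¬s s)
    ...   | no _  = refl

  truncate : Vec Entry n → Vec Entry n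
  truncate x = tabulate (truncEntry C x)

  module _ (x : Vec Entry n) (i : Fin n) where

    lookup-truncate : lookup (truncate x) i ≡ truncEntry C x i
    lookup-truncate = lookup∘tabulate (truncEntry C x) i

    lookup-truncate-cases :
      (∃ λ o → lookup x i ≡ just o × Shadowed x i o × lookup (truncate x) i ≡ nothing)
      ⊎ lookup (truncate x) i ≡ lookup x i
    lookup-truncate-cases with lookup x i in eq
    ... | nothing = inj₂ (trans lookup-truncate (truncEntry-nothing x i eq))
    ... | just o with shadowed? x i o
    ...   | yes s = inj₁ (o , refl , s , trans lookup-truncate (truncEntry-shadowed x i eq s))
    ...   | no ¬s = inj₂ (trans lookup-truncate (truncEntry-visible x i eq ¬s))

    lookup-truncate-preserves : (P : Entry → Set) → P nothing → P (lookup x i) → P (lookup (truncate x) i)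
    lookup-truncate-preserves P p₀ p with lookup-truncate-cases
    ... | inj₁ (_ , _ , _ , eq) = subst P (sym eq) p₀
    ... | inj₂ eq               = subst P (sym eq) p

    lookup-truncate-reflects : (P : Entry → Set) → ¬ P nothing → P (lookup (truncate x) i) → P (lookup x i)
    lookup-truncate-reflects P ¬p₀ p with lookup-truncate-cases
    ... | inj₁ (_ , _ , _ , eq) = ⊥-elim (¬p₀ (subst P eq p))
    ... | inj₂ eq               = subst P eq p

  lookup-truncate-just : ∀ x i {o} → lookup (truncate x) i ≡ just o → lookup x i ≡ just o
  lookup-truncate-just x i {o} = lookup-truncate-reflects x i (λ e → e ≡ just o) (λ ())

  above-untruncate : ∀ x i {o} → Above (truncate x) i o → Above x i o
  above-untruncate x i (i′ , i<i′ , eq) = i′ , i<i′ , lookup-truncate-just x i′ eq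

  -- The leftmost occurrence of a shadowed colour is not shadowed itself, so it survives truncation.
  above-truncate : ∀ x i {o} → Shadowed x i o → Above (truncate x) i o
  above-truncate x i {o} (odd , inC⁻ , i′ , i<i′ , eq) = go i′ (>-wellFounded i′) i<i′ eq
    where
    go : ∀ i′ → Acc _ i′ → i <ᶠ i′ → lookup x i′ ≡ just o → Above (truncate x) i o
    go i′ (acc rec) i<i′ eq with shadowed? x i′ o
    ... | yes (_ , _ , i″ , i′<i″ , eq′) = go i″ (rec i′<i″) (<ᶠ-trans i<i′ i′<i″) eq′
    ... | no ¬s = i′ , i<i′ , trans (lookup-truncate x i′) (truncEntry-visible x i′ eq ¬s)

  shadowed-truncate⇔ : ∀ x i o → Shadowed (truncate x) i o ⇔ Shadowed x i o
  shadowed-truncate⇔ x i o = mk⇔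
    (λ (odd , inC⁻ , a) → odd , inC⁻ , above-untruncate x i a)
    (λ s@(odd , inC⁻ , _) → odd , inC⁻ , above-truncate x i s)

  truncEntry-cong : ∀ x y i → lookup x i ≡ lookup y i → (∀ o → Shadowed x i o ⇔ Shadowed y i o)
    → truncEntry C x i ≡ truncEntry C y i
  truncEntry-cong x y i x≡y x⇔y = cases (lookup x i) refl
    where
    cases : ∀ e → lookup x i ≡ e → truncEntry C x i ≡ truncEntry C y i
    cases nothing eq = trans (truncEntry-nothing x i eq) (sym (truncEntry-nothing y i (trans (sym x≡y) eq)))
    cases (just o) eq with shadowed? x i o
    ... | yes s = trans (truncEntry-shadowed x i eq s)
                    (sym (truncEntry-shadowed y i (trans (sym x≡y) eq) (to (x⇔y o) s)))
    ... | no ¬s = trans (truncEntry-visible x i eq ¬s)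
                    (sym (truncEntry-visible y i (trans (sym x≡y) eq) (λ s → ¬s (from (x⇔y o) s))))

  truncEntry-idem : ∀ x i → truncEntry C (truncate x) i ≡ truncEntry C x i
  truncEntry-idem x i with lookup-truncate-cases x i
  ... | inj₁ (_ , _ , _ , eq) =
        trans (truncEntry-nothing (truncate x) i eq) (sym (trans (sym (lookup-truncate x i)) eq))
  ... | inj₂ eq = truncEntry-cong (truncate x) x i eq (shadowed-truncate⇔ x i)

  shadowed-setAt⇔ : ∀ x j v i o → j ≤ᶠ i → Shadowed (setAt x j v) i o ⇔ Shadowed x i o
  shadowed-setAt⇔ x j v i o j≤i = mk⇔
    (λ (odd , inC⁻ , i′ , i<i′ , eq) →
       odd , inC⁻ , i′ , i<i′ , trans (sym (setAt-> x j v i′ (ℕP.≤-<-trans j≤i i<i′))) eq)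
    (λ (odd , inC⁻ , i′ , i<i′ , eq) →
       odd , inC⁻ , i′ , i<i′ , trans (setAt-> x j v i′ (ℕP.≤-<-trans j≤i i<i′)) eq)

  truncEntry-setAt-> : ∀ x j v i → j <ᶠ i → truncEntry C (setAt x j v) i ≡ truncEntry C x i
  truncEntry-setAt-> x j v i j<i =
    truncEntry-cong (setAt x j v) x i (setAt-> x j v i j<i) (λ o → shadowed-setAt⇔ x j v i o (ℕP.<⇒≤ j<i))

  truncEntry-setAt-truncate : ∀ x j v i → truncEntry C (setAt (truncate x) j v) i ≡ truncEntry C (setAt x j v) i
  truncEntry-setAt-truncate x j v i with <-cmp i j
  ... | tri< i<j _ _ = trans (truncEntry-nothing (setAt (truncate x) j v) i (setAt-< (truncate x) j v i i<j))
                          (sym (truncEntry-nothing (setAt x j v) i (setAt-< x j v i i<j)))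
  ... | tri≈ _ refl _ = truncEntry-cong (setAt (truncate x) i v) (setAt x i v) i
                          (trans (setAt-≡ (truncate x) i v) (sym (setAt-≡ x i v)))
                          (λ o → ⇔.trans (shadowed-setAt⇔ (truncate x) i v i o ≤ᶠ-refl)
                                   (⇔.trans (shadowed-truncate⇔ x i o) (⇔.sym (shadowed-setAt⇔ x i v i o ≤ᶠ-refl))))
  ... | tri> _ _ j<i = trans (truncEntry-setAt-> (truncate x) j v i j<i)
                         (trans (truncEntry-idem x i) (sym (truncEntry-setAt-> x j v i j<i)))

  module _ (c : Vec Entry n) (d : ℕ) where

    geOrBlank-untruncate : ∀ i → (∀ i′ → i <ᶠ i′ → GeOrBlank d (lookup (truncate c) i′))
      → GeOrBlank d (lookup (truncate c) i) → GeOrBlank d (lookup c i)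
    geOrBlank-untruncate i ge-above ge with lookup-truncate-cases c i
    ... | inj₂ eq = subst (GeOrBlank d) eq ge
    ... | inj₁ (o , eq , s , _) with above-truncate c i s
    ...   | i′ , i<i′ , eq′ = subst (GeOrBlank d) (sym eq) (subst (GeOrBlank d) eq′ (ge-above i′ i<i′))

    geOrBlank-above-truncate⇔ : ∀ j → (∀ i → j <ᶠ i → GeOrBlank d (lookup (truncate c) i))
      ⇔ (∀ i → j <ᶠ i → GeOrBlank d (lookup c i))
    geOrBlank-above-truncate⇔ j = mk⇔
      (λ ge i j<i → geOrBlank-untruncate i (λ i′ i<i′ → ge i′ (<ᶠ-trans j<i i<i′)) (ge i j<i))
      (λ ge i j<i → lookup-truncate-preserves c i (GeOrBlank d) tt (ge i j<i))

    condI-truncate⇔ : ∀ j → CondI (truncate c) d j ⇔ CondI c d j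
    condI-truncate⇔ j = mk⇔
      (λ (evens , oddOrBlank , ge) →
         (λ i i<j → lookup-truncate-reflects c i IsEven (λ ()) (evens i i<j)) ,
         oddOrBlank-untruncate oddOrBlank , to (geOrBlank-above-truncate⇔ j) ge)
      (λ (evens , oddOrBlank , ge) →
         (λ i i<j → isEven-truncate i (evens i i<j)) ,
         lookup-truncate-preserves c j OddOrBlank tt oddOrBlank , from (geOrBlank-above-truncate⇔ j) ge)
      where
      oddOrBlank-untruncate : OddOrBlank (lookup (truncate c) j) → OddOrBlank (lookup c j)
      oddOrBlank-untruncate p with lookup-truncate-cases c j
      ... | inj₁ (o , eq , (odd , _) , _) = subst OddOrBlank (sym eq) odd
      ... | inj₂ eq = subst OddOrBlank eq p

      isEven-truncate : ∀ i → IsEven (lookup c i) → IsEven (lookup (truncate c) i)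
      isEven-truncate i p with lookup-truncate-cases c i
      ... | inj₁ (o , eq , (odd , _) , _) = ⊥-elim (even⇒¬odd {o} (subst IsEven eq p) odd)
      ... | inj₂ eq = subst IsEven (sym eq) p

    condII-truncate⇔ : ∀ j → CondII (truncate c) d j ⇔ CondII c d j
    condII-truncate⇔ j = mk⇔
      (λ (below , ge) → lookup-truncate-reflects c j (Below d) (λ ()) below , to (geOrBlank-above-truncate⇔ j) ge)
      (λ (below , ge) → below-truncate below ge , from (geOrBlank-above-truncate⇔ j) ge)
      where
      -- A shadowed entry below d would have an occurrence further left, also below d.
      below-truncate : Below d (lookup c j) → (∀ i → j <ᶠ i → GeOrBlank d (lookup c i))
        → Below d (lookup (truncate c) j)
      below-truncate below ge with lookup-truncate-cases c j
      ... | inj₁ (o , eq , (_ , _ , i′ , j<i′ , eq′) , _) =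
            ⊥-elim (geOrBlank⇒¬below d (just o) (subst (GeOrBlank d) eq′ (ge i′ j<i′)) (subst (Below d) eq below))
      ... | inj₂ eq = subst (Below d) (sym eq) below

    condIII-truncate⇔ : CondIII (truncate c) d ⇔ CondIII c d
    condIII-truncate⇔ = mk⇔
      (λ ge i → geOrBlank-untruncate i (λ i′ _ → ge i′) (ge i))
      (λ ge i → lookup-truncate-preserves c i (GeOrBlank d) tt (ge i))

  truncate-ruEquivalent : ∀ c d → RuEquivalent C d (truncate c) c
  truncate-ruEquivalent c d = record
    { condI⇔   = condI-truncate⇔ c d
    ; condII⇔  = condII-truncate⇔ c d
    ; condIII⇔ = condIII-truncate⇔ c d
    ; ↓₁-setAt = λ j v → cong wit (tabulate-cong (truncEntry-setAt-truncate c j v))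
    ; ↓₁-wit   = cong wit (tabulate-cong (truncEntry-idem c))
    }

open Truncation using (truncate-ruEquivalent)

lemma6 : (C : Colours) (k : ℕ) (b c : Wit (suc k)) (d : ℕ)
       → WellFormed C c → InC C d
       → b ≡ ↓₁ C c
       → ru C b d ≡ ↓₁ C (ru′ C c d)
lemma6 C k b top     d _ _ refl = refl
lemma6 C k b (wit c) d _ _ refl = ru-cong (truncate-ruEquivalent C c d)
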